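{- Let $r,r'\in\mathbb{R}_1=(0,1)$ with $r<r'$, with continued fraction expansions $r=[b_1,b_2,\dots]$, $r'=[b'_1,b'_2,\dots]$, and let $C(r)=C_I(b_1)\,C_{II}(b_2)\,C_I(b_3)\,C_{II}(b_4)\cdots\in A^\omega$ and likewise $C(r')$ (for rational $r$, the expansion is the finite one with an even number of partial denominators, and the encoding is terminated by $C_I(\aleph_0)=0^\omega$). Then $C(r)<C(r')$ in lexicographic order.
   Context: $A=\{0,1\}$, $A^\omega$ infinite binary words; $\overline{w}$ is the bitwise complement of a word $w$. For $b\in\mathbb{N}$ with binary expansion $b=\sum_{k=0}^l b_k2^k$, $l=\lfloor\log_2 b\rfloor$, $C_I(b)=0^l\,1\,\overline{b_{l-1}}\cdots\overline{b_0}$ and $C_{II}(b)=\overline{C_I(b)}=1^l\,0\,b_{l-1}\cdots b_0$; $C_I(\aleph_0)=0^\omega$. Continued fraction expansion of $r\in(0,1)$: $r=\cfrac{1}{b_1+\cfrac{1}{b_2+\cdots}}$ with partial denominators $b_i\in\mathbb{N}$, infinite for irrational $r$; a rational $r\in(0,1)$ is written with the unique finite expansion $[b_1,\dots,b_{2l}]$ of even length (using $[\dots,b_m]=[\dots,b_m-1,1]$). -}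

module Defs where

open import Data.Bool using (Bool; true; false; not; if_then_else_)
open import Data.Nat using (ℕ; zero; suc; _+_; _*_; _<_; _≤_; _%_; ⌊_/2⌋; _≡ᵇ_; _<ᵇ_)
open import Data.Nat.Logarithm using (⌊log₂_⌋)
open import Data.List using (List; []; _∷_; _++_; replicate; map; downFrom; applyUpTo; concat; length)
open import Data.List.Relation.Unary.All using (All)
open import Data.Product using (_×_; _,_; ∃; ∃-syntax)
open import Relation.Binary.PropositionalEquality using (_≡_)

-- Binary codes.  Bits: false = 0, true = 1.

-- k-th binary digit b_k of b (b = Σ b_k 2^k)
bit : ℕ → ℕ → Bool
bit b zero    = (b % 2) ≡ᵇ 1
bit b (suc k) = bit ⌊ b /2⌋ k

-- C_I(b) = 0^l 1 ¬b_{l-1} ... ¬b_0, with l = ⌊log₂ b⌋   (for b ≥ 1)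
C-I : ℕ → List Bool
C-I b = replicate ⌊log₂ b ⌋ false ++ (true ∷ map (λ k → not (bit b k)) (downFrom ⌊log₂ b ⌋))

C-II : ℕ → List Bool
C-II b = map not (C-I b)

-- code of the partial denominator at 0-based position i:
-- positions 0,2,4,… (i.e. b_1,b_3,…) use C_I, positions 1,3,… use C_II
codeAt : ℕ → ℕ → List Bool
codeAt zero          b = C-I b
codeAt (suc zero)    b = C-II b
codeAt (suc (suc i)) b = codeAt i b

Word : Set
Word = ℕ → Bool

nthD : List Bool → ℕ → Bool
nthD []       _       = false
nthD (x ∷ xs) zero    = x
nthD (x ∷ xs) (suc n) = nthD xs n

-- infinite concatenation of a sequence of (nonempty) finite words:
-- position n lies within the first n+1 blocks.
flatten : (ℕ → List Bool) → Word
flatten blocks n = nthD (concat (applyUpTo blocks (suc n))) n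

_<lex_ : Word → Word → Set
w <lex w' = ∃[ n ] ((∀ m → m < n → w m ≡ w' m) × (w n ≡ false) × (w' n ≡ true))

-- A real r ∈ (0,1) is given by its (unique) expansion r = [b₁,b₂,…]:
-- irrational: infinite sequence of positive integers;
-- rational: finite list of positive integers of even (nonzero) length.

data CFExp : Set where
  fin : (bs : List ℕ) → All (1 ≤_) bs → (∃[ l ] length bs ≡ 2 * suc l) → CFExp
  inf : (b : ℕ → ℕ) → (∀ i → 1 ≤ b i) → CFExp

-- value of a finite continued fraction 1/(b₁ + 1/(b₂ + …)) as a fraction (p , q) = p/q
evalCF : List ℕ → ℕ × ℕ
evalCF []       = 0 , 1
evalCF (b ∷ bs) with evalCF bs
... | p , q = q , b * q + p

-- p/q < p'/q'  (positive denominators)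
_<F_ : ℕ × ℕ → ℕ × ℕ → Set
(p , q) <F (p' , q') = p * q' < p' * q

conv : (ℕ → ℕ) → ℕ → ℕ × ℕ
conv b n = evalCF (applyUpTo b n)

-- Dedekind cut of the real number denoted by an expansion (rationals a/c, c ≥ 1):
-- a/c < r   (even convergents increase to r)
Below : ℕ × ℕ → CFExp → Set
Below x (fin bs _ _) = x <F evalCF bs
Below x (inf b _)    = ∃[ k ] (x <F conv b (2 * k))

-- r < a/c   (odd convergents decrease to r)
Above : CFExp → ℕ × ℕ → Set
Above (fin bs _ _) x = evalCF bs <F x
Above (inf b _)    x = ∃[ k ] (conv b (suc (2 * k)) <F x)

_<ℝ_ : CFExp → CFExp → Set
r <ℝ r' = ∃[ a ] ∃[ c ] ((1 ≤ c) × Above r (a , c) × Below (a , c) r')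

-- The encoding C(r) = C_I(b₁) C_II(b₂) C_I(b₃) …, terminated by
-- C_I(ℵ₀) = 0^ω in the rational case.

lookupD : List ℕ → ℕ → ℕ
lookupD []       _       = 0
lookupD (x ∷ xs) zero    = x
lookupD (x ∷ xs) (suc i) = lookupD xs i

blocks : CFExp → ℕ → List Bool
blocks (fin bs _ _) i = if i <ᵇ length bs then codeAt i (lookupD bs i) else (false ∷ [])
blocks (inf b _)    i = codeAt i (b i)

C : CFExp → Word
C r = flatten (blocks r)

module Submission where

-- Both codes are concatenations of blocks, the i-th block being
-- codeAt i b for the i-th partial denominator b (C_I at even i, C_II at odd i).
--   1. Finite words: a comparison xs ≺ ys of finite words (first difference is
--      0 versus 1) transfers to any infinite words beginning with xs and ys, and
--      the infinite concatenation of nonempty blocks begins with every finite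
--      concatenation of its first blocks.
--   2. Codes: C_I(y) = 0 C_I(⌊y/2⌋) ¬y₀ for y ≥ 2, whence C_I is strictly
--      antitone on positive integers (well-founded induction), and C_II = ¬C_I
--      is strictly monotone.
--   3. Continued fractions: t ↦ 1/(c + t) reverses order, so a common prefix of
--      even length preserves, and one of odd length reverses, the order of the
--      tails; a larger first partial denominator gives a smaller value.
--   4. From a rational a/c with r < a/c < r' we obtain an initial segment L of the
--      expansion of r (all of it if r is rational, else an odd convergent) and an
--      even-length initial segment L' of that of r' with [L] < a/c < [L'].
--   5. At the first difference of L and L', step 3 forces either digits y ≠ y'
--      ordered so that their codes satisfy ≺ (step 2), or L is a proper prefix of
--      even length: then C(r) continues with 0^ω and C(r') with C_I(z), which
--      contains a 1.  Step 1 turns either situation into C(r) <lex C(r').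

open import Defs
open import Data.Bool using (Bool; true; false; not; if_then_else_)
open import Data.Bool.Properties using (not-involutive)
open import Data.Empty using (⊥-elim)
open import Data.List using (List; []; _∷_; _++_; _∷ʳ_; length; map; replicate; concat; applyUpTo; applyDownFrom; downFrom)
open import Data.List.Properties using (++-assoc; length-++; length-map; length-applyUpTo; map-applyDownFrom; applyDownFrom-∷ʳ)
open import Data.List.Relation.Unary.All using (All; _∷_)
open import Data.List.Relation.Unary.All.Properties using (++⁻ˡ; ++⁻ʳ; applyUpTo⁺₂)
open import Data.Nat using (ℕ; zero; suc; _+_; _*_; _∸_; _≤_; _<_; z≤n; s≤s; z<s; s<s; _%_; ⌊_/2⌋; _≡ᵇ_; _<ᵇ_; _≟_; >-nonZero)
open import Data.Nat.DivMod using ([m+n]%n≡m%n)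
open import Data.Nat.Induction using (<-wellFounded)
open import Data.Nat.Logarithm using (⌊log₂_⌋; ⌊log₂⌋-mono-≤; ⌊log₂⌊n/2⌋⌋≡⌊log₂n⌋∸1)
open import Data.Nat.Properties
open import Data.Nat.Solver using (module +-*-Solver)
open import Data.Product using (_×_; _,_; proj₁; proj₂)
open import Data.Sum using (_⊎_; inj₁; inj₂)
open import Data.Unit using (tt)
open import Function using (_∘_; id)
open import Induction.WellFounded using (Acc; acc)
open import Relation.Binary using (tri<; tri≈; tri>)
open import Relation.Binary.PropositionalEquality
open import Relation.Nullary using (¬_; yes; no)
open +-*-Solver using (solve; _:=_; _:*_)

infix 4 _≺_ _Extends_

data _≺_ : List Bool → List Bool → Set where
  here  : ∀ {xs ys} → false ∷ xs ≺ true ∷ ys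
  there : ∀ {x xs ys} → xs ≺ ys → x ∷ xs ≺ x ∷ ys

≺-prefix : ∀ zs {xs ys} → xs ≺ ys → zs ++ xs ≺ zs ++ ys
≺-prefix []       p = p
≺-prefix (z ∷ zs) p = there (≺-prefix zs p)

-- the comparison is decided before either word ends, so any suffixes may follow
≺-suffix : ∀ {xs ys} us vs → xs ≺ ys → xs ++ us ≺ ys ++ vs
≺-suffix us vs here      = here
≺-suffix us vs (there p) = there (≺-suffix us vs p)

≺-complement : ∀ {xs ys} → xs ≺ ys → map not ys ≺ map not xs
≺-complement here      = here
≺-complement (there p) = there (≺-complement p)

zeros≺ : ∀ l xs → replicate (suc l) false ≺ replicate l false ++ true ∷ xs
zeros≺ zero    xs = here
zeros≺ (suc l) xs = there (zeros≺ l xs)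

_Extends_ : Word → List Bool → Set
w Extends xs = ∀ n → n < length xs → w n ≡ nthD xs n

≺⇒<lex : ∀ {xs ys w w'} → xs ≺ ys → w Extends xs → w' Extends ys → w <lex w'
≺⇒<lex here      w⊒xs w'⊒ys = 0 , (λ _ ()) , w⊒xs 0 z<s , w'⊒ys 0 z<s
≺⇒<lex {w = w} {w'} (there p) w⊒xs w'⊒ys
  with ≺⇒<lex p (λ n n< → w⊒xs (suc n) (s<s n<)) (λ n n< → w'⊒ys (suc n) (s<s n<))
... | n , agree , w₀ , w'₁ = suc n , agree' , w₀ , w'₁
  where
  agree' : ∀ m → m < suc n → w m ≡ w' m
  agree' zero    _         = trans (w⊒xs 0 z<s) (sym (w'⊒ys 0 z<s))
  agree' (suc m) (s<s m<n) = agree m m<n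

nthD-++ˡ : ∀ xs ys n → n < length xs → nthD (xs ++ ys) n ≡ nthD xs n
nthD-++ˡ (x ∷ xs) ys zero    _         = refl
nthD-++ˡ (x ∷ xs) ys (suc n) (s<s n<l) = nthD-++ˡ xs ys n n<l

firstBlocks : (ℕ → List Bool) → ℕ → List Bool
firstBlocks B m = concat (applyUpTo B m)

-- nonempty blocks make the infinite concatenation well defined
NonEmptyBlocks : (ℕ → List Bool) → Set
NonEmptyBlocks B = ∀ k → 1 ≤ length (B k)

firstBlocks-+ : ∀ B m n → firstBlocks B (m + n) ≡ firstBlocks B m ++ firstBlocks (λ k → B (m + k)) n
firstBlocks-+ B zero    n = refl
firstBlocks-+ B (suc m) n =
  trans (cong (B 0 ++_) (firstBlocks-+ (B ∘ suc) m n)) (sym (++-assoc (B 0) _ _))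

firstBlocks-length : ∀ {B} → NonEmptyBlocks B → ∀ m → m ≤ length (firstBlocks B m)
firstBlocks-length ne zero    = z≤n
firstBlocks-length {B} ne (suc m) rewrite length-++ (B 0) {firstBlocks (B ∘ suc) m} =
  +-mono-≤ (ne 0) (firstBlocks-length (ne ∘ suc) m)

firstBlocks-cong : ∀ {B B'} i → (∀ k → k < i → B k ≡ B' k) → firstBlocks B i ≡ firstBlocks B' i
firstBlocks-cong zero    common = refl
firstBlocks-cong (suc i) common =
  cong₂ _++_ (common 0 z<s) (firstBlocks-cong i (λ k k<i → common (suc k) (s<s k<i)))

firstBlocks-zeros : ∀ {B} → (∀ k → B k ≡ false ∷ []) → ∀ n → firstBlocks B n ≡ replicate n false
firstBlocks-zeros zeros zero    = refl
firstBlocks-zeros zeros (suc n) rewrite zeros 0 = cong (false ∷_) (firstBlocks-zeros (zeros ∘ suc) n)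

nthD-firstBlocks : ∀ B {m m'} n → m ≤ m' → n < length (firstBlocks B m) →
                   nthD (firstBlocks B m') n ≡ nthD (firstBlocks B m) n
nthD-firstBlocks B {m} {m'} n m≤m' n<l = begin
    nthD (firstBlocks B m') n
  ≡⟨ cong (λ j → nthD (firstBlocks B j) n) (sym (m+[n∸m]≡n m≤m')) ⟩
    nthD (firstBlocks B (m + (m' ∸ m))) n
  ≡⟨ cong (λ xs → nthD xs n) (firstBlocks-+ B m (m' ∸ m)) ⟩
    nthD (firstBlocks B m ++ firstBlocks (λ k → B (m + k)) (m' ∸ m)) n
  ≡⟨ nthD-++ˡ (firstBlocks B m) _ n n<l ⟩
    nthD (firstBlocks B m) n ∎
  where open ≡-Reasoning

flatten-extends : ∀ {B} → NonEmptyBlocks B → ∀ m → flatten B Extends firstBlocks B m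
flatten-extends {B} ne m n n<l with ≤-total m (suc n)
... | inj₁ m≤1+n = nthD-firstBlocks B n m≤1+n n<l
... | inj₂ 1+n≤m = sym (nthD-firstBlocks B n 1+n≤m (firstBlocks-length {B} ne (suc n)))

lex-after-common-blocks : ∀ {B B'} i n n' → NonEmptyBlocks B → NonEmptyBlocks B' →
  (∀ k → k < i → B k ≡ B' k) →
  firstBlocks (λ k → B (i + k)) n ≺ firstBlocks (λ k → B' (i + k)) n' →
  flatten B <lex flatten B'
lex-after-common-blocks {B} {B'} i n n' ne ne' common p =
  ≺⇒<lex (≺-prefix (firstBlocks B' i) p) begins begins'
  where
  begins : flatten B Extends (firstBlocks B' i ++ firstBlocks (λ k → B (i + k)) n)
  begins = subst (λ zs → flatten B Extends (zs ++ _)) (firstBlocks-cong i common)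
             (subst (flatten B Extends_) (firstBlocks-+ B i n) (flatten-extends ne (i + n)))
  begins' : flatten B' Extends (firstBlocks B' i ++ firstBlocks (λ k → B' (i + k)) n')
  begins' = subst (flatten B' Extends_) (firstBlocks-+ B' i n') (flatten-extends ne' (i + n'))

lex-at-block : ∀ {B B'} i → NonEmptyBlocks B → NonEmptyBlocks B' →
  (∀ k → k < i → B k ≡ B' k) → B i ≺ B' i → flatten B <lex flatten B'
lex-at-block {B} {B'} i ne ne' common p = lex-after-common-blocks i 1 1 ne ne' common
  (subst₂ (λ j j' → B j ++ [] ≺ B' j' ++ []) (sym (+-identityʳ i)) (sym (+-identityʳ i))
    (≺-suffix [] [] p))

-- The codes C_I and C_II

complement-digits-step : ∀ y l →
  map (λ k → not (bit y k)) (downFrom (suc l))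
    ≡ map (λ k → not (bit ⌊ y /2⌋ k)) (downFrom l) ∷ʳ not (bit y 0)
complement-digits-step y l = begin
    map digit (downFrom (suc l))              ≡⟨ map-applyDownFrom id digit (suc l) ⟩
    applyDownFrom digit (suc l)               ≡⟨ sym (applyDownFrom-∷ʳ digit l) ⟩
    applyDownFrom (digit ∘ suc) l ∷ʳ digit 0  ≡⟨ cong (_∷ʳ digit 0) (sym (map-applyDownFrom id (digit ∘ suc) l)) ⟩
    map (digit ∘ suc) (downFrom l) ∷ʳ digit 0 ∎
  where
  open ≡-Reasoning
  digit : ℕ → Bool
  digit k = not (bit y k)

log₂-halve : ∀ y → 2 ≤ y → ⌊log₂ y ⌋ ≡ suc ⌊log₂ ⌊ y /2⌋ ⌋
log₂-halve y 2≤y =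
  trans (sym (m+[n∸m]≡n (⌊log₂⌋-mono-≤ 2≤y))) (cong suc (sym (⌊log₂⌊n/2⌋⌋≡⌊log₂n⌋∸1 y)))

C-I-halve : ∀ y → 2 ≤ y → C-I y ≡ false ∷ (C-I ⌊ y /2⌋ ∷ʳ not (bit y 0))
C-I-halve y 2≤y = unfolded (log₂-halve y 2≤y)
  where
  h = ⌊ y /2⌋
  unfolded : ∀ {l} → l ≡ suc ⌊log₂ h ⌋ →
    replicate l false ++ true ∷ map (λ k → not (bit y k)) (downFrom l)
      ≡ false ∷ (C-I h ∷ʳ not (bit y 0))
  unfolded refl rewrite complement-digits-step y ⌊log₂ h ⌋ =
    cong (false ∷_) (sym (++-assoc (replicate ⌊log₂ h ⌋ false) (true ∷ _) _))

bit0-skip2 : ∀ n → bit (2 + n) 0 ≡ bit n 0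
bit0-skip2 n = cong (_≡ᵇ 1) (trans (cong (_% 2) (+-comm 2 n)) ([m+n]%n≡m%n n 2))

lowest-digit-split : ∀ y → (bit y 0 ≡ false × y ≡ ⌊ y /2⌋ + ⌊ y /2⌋)
             ⊎ (bit y 0 ≡ true  × y ≡ suc (⌊ y /2⌋ + ⌊ y /2⌋))
lowest-digit-split zero          = inj₁ (refl , refl)
lowest-digit-split (suc zero)    = inj₂ (refl , refl)
lowest-digit-split (suc (suc n)) with lowest-digit-split n
... | inj₁ (b , e) = inj₁ (trans (bit0-skip2 n) b , cong suc (trans (cong suc e) (sym (+-suc _ _))))
... | inj₂ (b , e) = inj₂ (trans (bit0-skip2 n) b , cong (suc ∘ suc) (trans e (sym (+-suc _ _))))

lowest-digit-order : ∀ {y y'} → ⌊ y' /2⌋ ≡ ⌊ y /2⌋ → y' < y → bit y' 0 ≡ false × bit y 0 ≡ true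
lowest-digit-order {y} {y'} same-half y'<y with lowest-digit-split y' | lowest-digit-split y
... | inj₁ (b' , _) | inj₂ (b , _) = b' , b
... | inj₁ (_ , e') | inj₁ (_ , e) =
  ⊥-elim (<-irrefl (trans e' (trans (cong (λ h → h + h) same-half) (sym e))) y'<y)
... | inj₂ (_ , e') | inj₂ (_ , e) =
  ⊥-elim (<-irrefl (trans e' (trans (cong (λ h → suc (h + h)) same-half) (sym e))) y'<y)
... | inj₂ (_ , e') | inj₁ (_ , e) =
  ⊥-elim (<⇒≱ y'<y (subst₂ _≤_ (sym e) (sym e')
    (subst (λ h → ⌊ y /2⌋ + ⌊ y /2⌋ ≤ suc (h + h)) (sym same-half) (n≤1+n _))))

C-I-antitone : ∀ {y y'} → 1 ≤ y' → y' < y → C-I y ≺ C-I y'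
C-I-antitone {y} = go (<-wellFounded y)
  where
  go : ∀ {y y'} → Acc _<_ y → 1 ≤ y' → y' < y → C-I y ≺ C-I y'
  go {y} {suc zero} _ _ 1<y rewrite C-I-halve y 1<y = here
  go {zero} {suc (suc _)} _ _ ()
  go {y@(suc n)} {y'@(suc (suc _))} (acc smaller) _ y'<y
    rewrite C-I-halve y (≤-trans (s≤s (s≤s z≤n)) (<⇒≤ y'<y)) | C-I-halve y' (s≤s (s≤s z≤n))
    with m≤n⇒m<n∨m≡n (⌊n/2⌋-mono (<⇒≤ y'<y))
  ... | inj₁ h'<h = there (≺-suffix _ _ (go (smaller (⌊n/2⌋<n n)) z<s h'<h))
  ... | inj₂ h'≡h with lowest-digit-order h'≡h y'<y
  ...   | b' , b rewrite b | b' | h'≡h = there (≺-prefix (C-I ⌊ y /2⌋) here)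

C-II-monotone : ∀ {y y'} → 1 ≤ y → y < y' → C-II y ≺ C-II y'
C-II-monotone 1≤y y<y' = ≺-complement (C-I-antitone 1≤y y<y')

C-I-nonempty : ∀ b → 1 ≤ length (C-I b)
C-I-nonempty b rewrite length-++ (replicate ⌊log₂ b ⌋ false) {true ∷ map (λ k → not (bit b k)) (downFrom ⌊log₂ b ⌋)} =
  ≤-trans (s≤s z≤n) (m≤n+m _ _)

codeAt-nonempty : ∀ i b → 1 ≤ length (codeAt i b)
codeAt-nonempty zero          b = C-I-nonempty b
codeAt-nonempty (suc zero)    b = subst (1 ≤_) (sym (length-map not (C-I b))) (C-I-nonempty b)
codeAt-nonempty (suc (suc i)) b = codeAt-nonempty i b

blocks-nonempty : ∀ r → NonEmptyBlocks (blocks r)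
blocks-nonempty (fin bs _ _) i with i <ᵇ length bs
... | true  = codeAt-nonempty i _
... | false = s≤s z≤n
blocks-nonempty (inf b _)    i = codeAt-nonempty i (b i)

isEven : ℕ → Bool
isEven zero    = true
isEven (suc n) = not (isEven n)

isEven-double : ∀ k → isEven (2 * k) ≡ true
isEven-double zero    = refl
isEven-double (suc k) rewrite +-suc k (k + 0) = cong (not ∘ not) (isEven-double k)

-- case split on the parity without abstracting isEven n in the context
even-or-odd : ∀ n → isEven n ≡ true ⊎ isEven n ≡ false
even-or-odd n with isEven n
... | true  = inj₁ refl
... | false = inj₂ refl

codeAt-parity : ∀ i b → codeAt i b ≡ (if isEven i then C-I b else C-II b)
codeAt-parity zero          b = refl
codeAt-parity (suc zero)    b = refl
codeAt-parity (suc (suc i)) b rewrite not-involutive (isEven i) = codeAt-parity i b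

-- Order of finite continued fractions

_≤F_ : ℕ × ℕ → ℕ × ℕ → Set
(p , q) ≤F (p' , q') = p * q' ≤ p' * q

<F⇒≱F : ∀ x y → x <F y → ¬ (y ≤F x)
<F⇒≱F _ _ = <⇒≱

Oriented : Bool → ℕ × ℕ → ℕ × ℕ → Set
Oriented true  x y = x ≤F y
Oriented false x y = y ≤F x

oriented-even : ∀ n {x y} → isEven n ≡ true → Oriented (isEven n) x y → x ≤F y
oriented-even n {x} {y} even h = subst (λ b → Oriented b x y) even h

oriented-odd : ∀ n {x y} → isEven n ≡ false → Oriented (isEven n) x y → y ≤F x
oriented-odd n {x} {y} odd h = subst (λ b → Oriented b x y) odd h

evalCF-cons-antitone : ∀ c xs ys → evalCF ys ≤F evalCF xs → evalCF (c ∷ xs) ≤F evalCF (c ∷ ys)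
evalCF-cons-antitone c xs ys ys≤xs = begin
    q * (c * q' + p')       ≡⟨ *-distribˡ-+ q (c * q') p' ⟩
    q * (c * q') + q * p'   ≤⟨ +-mono-≤ (≤-reflexive (solve 3 (λ c q q' → q :* (c :* q') := q' :* (c :* q)) refl c q q'))
                                        (≤-reflexive (*-comm q p')) ⟩
    q' * (c * q) + p' * q   ≤⟨ +-monoʳ-≤ (q' * (c * q)) (≤-trans ys≤xs (≤-reflexive (*-comm p q'))) ⟩
    q' * (c * q) + q' * p   ≡⟨ sym (*-distribˡ-+ q' (c * q) p) ⟩
    q' * (c * q + p)        ∎
  where
  open ≤-Reasoning
  p = proj₁ (evalCF xs)
  q = proj₂ (evalCF xs)
  p' = proj₁ (evalCF ys)
  q' = proj₂ (evalCF ys)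

evalCF-cons-flip : ∀ b c xs ys → Oriented b (evalCF xs) (evalCF ys) →
                   Oriented (not b) (evalCF (c ∷ xs)) (evalCF (c ∷ ys))
evalCF-cons-flip true  c xs ys h = evalCF-cons-antitone c ys xs h
evalCF-cons-flip false c xs ys h = evalCF-cons-antitone c xs ys h

evalCF-extension : ∀ P s → Oriented (isEven (length P)) (evalCF P) (evalCF (P ++ s))
evalCF-extension []      s = z≤n
evalCF-extension (c ∷ P) s = evalCF-cons-flip _ c P (P ++ s) (evalCF-extension P s)

evalCF-common-prefix : ∀ P {xs ys} → evalCF xs ≤F evalCF ys →
                       Oriented (isEven (length P)) (evalCF (P ++ xs)) (evalCF (P ++ ys))
evalCF-common-prefix []      xs≤ys = xs≤ys
evalCF-common-prefix (c ∷ P) xs≤ys = evalCF-cons-flip _ c (P ++ _) (P ++ _) (evalCF-common-prefix P xs≤ys)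

evalCF-≤1 : ∀ t → All (1 ≤_) t → proj₁ (evalCF t) ≤ proj₂ (evalCF t)
evalCF-≤1 []      _          = z≤n
evalCF-≤1 (b ∷ t) (1≤b ∷ _) =
  ≤-trans (≤-trans (≤-reflexive (sym (*-identityˡ q))) (*-monoˡ-≤ q 1≤b)) (m≤m+n (b * q) _)
  where q = proj₂ (evalCF t)

evalCF-denominator-positive : ∀ t → All (1 ≤_) t → 1 ≤ proj₂ (evalCF t)
evalCF-denominator-positive []      _              = s≤s z≤n
evalCF-denominator-positive (b ∷ t) (1≤b ∷ t-pos) =
  ≤-trans (*-mono-≤ 1≤b (evalCF-denominator-positive t t-pos)) (m≤m+n (b * _) _)

-- a larger first partial denominator gives a smaller value: 1/(y'+t') ≤ 1/(y+t)
-- when y < y' and t ≤ 1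
evalCF-larger-head : ∀ {y y' t t'} → y < y' → All (1 ≤_) t → evalCF (y' ∷ t') ≤F evalCF (y ∷ t)
evalCF-larger-head {y} {y'} {t} {t'} y<y' t-pos = begin
    q' * (y * q + p)      ≤⟨ *-monoʳ-≤ q' (+-monoʳ-≤ (y * q) (evalCF-≤1 t t-pos)) ⟩
    q' * (y * q + q)      ≡⟨ cong (q' *_) (+-comm (y * q) q) ⟩
    q' * (suc y * q)      ≤⟨ *-monoʳ-≤ q' (*-monoˡ-≤ q y<y') ⟩
    q' * (y' * q)         ≡⟨ solve 3 (λ q q' y' → q' :* (y' :* q) := (y' :* q') :* q) refl q q' y' ⟩
    (y' * q') * q         ≤⟨ *-monoˡ-≤ q (m≤m+n (y' * q') p') ⟩
    (y' * q' + p') * q    ≡⟨ *-comm (y' * q' + p') q ⟩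
    q * (y' * q' + p')    ∎
  where
  open ≤-Reasoning
  p = proj₁ (evalCF t)
  q = proj₂ (evalCF t)
  p' = proj₁ (evalCF t')
  q' = proj₂ (evalCF t')

evalCF-divergence : ∀ P {y y' t t'} → y < y' → All (1 ≤_) t →
                    Oriented (isEven (length P)) (evalCF (P ++ y' ∷ t')) (evalCF (P ++ y ∷ t))
evalCF-divergence P {t' = t'} y<y' t-pos = evalCF-common-prefix P (evalCF-larger-head {t' = t'} y<y' t-pos)

<F-trans : ∀ x y z → 1 ≤ proj₂ x → 1 ≤ proj₂ z → x <F y → y <F z → x <F z
<F-trans (p , q) (a , c) (p' , q') 1≤q 1≤q' x<y y<z = *-cancelʳ-< c (p * q') (p' * q) (begin-strict
    (p * q') * c    ≡⟨ solve 3 (λ p q' c → (p :* q') :* c := (p :* c) :* q') refl p q' c ⟩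
    (p * c) * q'    <⟨ *-monoˡ-< q' {{>-nonZero 1≤q'}} x<y ⟩
    (a * q) * q'    ≡⟨ solve 3 (λ a q q' → (a :* q) :* q' := (a :* q') :* q) refl a q q' ⟩
    (a * q') * q    <⟨ *-monoˡ-< q {{>-nonZero 1≤q}} y<z ⟩
    (p' * c) * q    ≡⟨ solve 3 (λ p' c q → (p' :* c) :* q := (p' :* q) :* c) refl p' c q ⟩
    (p' * q) * c    ∎)
  where open ≤-Reasoning

data Comparison (L L' : List ℕ) : Set where
  equal            : L ≡ L' → Comparison L L'
  proper-prefix    : ∀ z t → L' ≡ L ++ z ∷ t → Comparison L L'
  proper-extension : ∀ z t → L ≡ L' ++ z ∷ t → Comparison L L'
  diverge          : ∀ P y t y' t' → y ≢ y' → L ≡ P ++ y ∷ t → L' ≡ P ++ y' ∷ t' → Comparison L L'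

first-difference : ∀ L L' → Comparison L L'
first-difference []      []        = equal refl
first-difference []      (z ∷ t)   = proper-prefix z t refl
first-difference (z ∷ t) []        = proper-extension z t refl
first-difference (x ∷ L) (x' ∷ L') with x ≟ x'
... | no x≢x' = diverge [] x L x' L' x≢x' refl refl
... | yes refl with first-difference L L'
...   | equal e                       = equal (cong (x ∷_) e)
...   | proper-prefix z t e           = proper-prefix z t (cong (x ∷_) e)
...   | proper-extension z t e        = proper-extension z t (cong (x ∷_) e)
...   | diverge P y t y' t' y≢y' e e' = diverge (x ∷ P) y t y' t' y≢y' (cong (x ∷_) e) (cong (x ∷_) e')

lookupD-++ˡ : ∀ P xs k → k < length P → lookupD (P ++ xs) k ≡ lookupD P k
lookupD-++ˡ (x ∷ P) xs zero    _         = refl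
lookupD-++ˡ (x ∷ P) xs (suc k) (s<s k<l) = lookupD-++ˡ P xs k k<l

lookupD-at-length : ∀ P y t → lookupD (P ++ y ∷ t) (length P) ≡ y
lookupD-at-length []      y t = refl
lookupD-at-length (x ∷ P) y t = lookupD-at-length P y t

lookupD-applyUpTo : ∀ (b : ℕ → ℕ) n i → i < n → lookupD (applyUpTo b n) i ≡ b i
lookupD-applyUpTo b (suc n) zero    _         = refl
lookupD-applyUpTo b (suc n) (suc i) (s<s i<n) = lookupD-applyUpTo (b ∘ suc) n i i<n

length-<-++ : ∀ (P xs : List ℕ) {k} → k < length P → k < length (P ++ xs)
length-<-++ P xs k<l rewrite length-++ P {xs} = ≤-trans k<l (m≤m+n _ _)

-- L lists the first |L| partial denominators of r, as seen through the blocks of C(r)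
record InitialSegment (r : CFExp) (L : List ℕ) : Set where
  field
    positive : All (1 ≤_) L
    codes    : ∀ i → i < length L → blocks r i ≡ codeAt i (lookupD L i)

-- an even-length initial segment of a rational expansion exhausts it, and the code
-- continues with 0^ω
EndsAfter : CFExp → List ℕ → Set
EndsAfter r L = isEven (length L) ≡ true → ∀ n → blocks r (length L + n) ≡ false ∷ []

segment-shorten : ∀ {r} P {s} → InitialSegment r (P ++ s) → InitialSegment r P
segment-shorten P {s} seg = record
  { positive = ++⁻ˡ P positive
  ; codes    = λ i i<l → trans (codes i (length-<-++ P s i<l)) (cong (codeAt i) (lookupD-++ˡ P s i i<l))
  }
  where open InitialSegment seg

segment-next-positive : ∀ {r} P {y t} → InitialSegment r (P ++ y ∷ t) → 1 ≤ y × All (1 ≤_) t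
segment-next-positive P seg with ++⁻ʳ P (InitialSegment.positive seg)
... | 1≤y ∷ t-pos = 1≤y , t-pos

segment-next-code : ∀ {r} P {y t} → InitialSegment r (P ++ y ∷ t) → blocks r (length P) ≡ codeAt (length P) y
segment-next-code P {y} {t} seg = trans (InitialSegment.codes seg (length P) next<length)
  (cong (codeAt (length P)) (lookupD-at-length P y t))
  where
  next<length : length P < length (P ++ y ∷ t)
  next<length rewrite length-++ P {y ∷ t} = m<m+n (length P) z<s

segments-agree : ∀ {r r' L} → InitialSegment r L → InitialSegment r' L →
                 ∀ k → k < length L → blocks r k ≡ blocks r' k
segments-agree seg seg' k k<l = trans (InitialSegment.codes seg k k<l) (sym (InitialSegment.codes seg' k k<l))

finite-segment : ∀ bs pos len → InitialSegment (fin bs pos len) bs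
finite-segment bs pos len = record { positive = pos ; codes = codes }
  where
  codes : ∀ i → i < length bs → blocks (fin bs pos len) i ≡ codeAt i (lookupD bs i)
  codes i i<l with i <ᵇ length bs | <⇒<ᵇ i<l
  ... | true | _ = refl

finite-ends : ∀ bs pos len → EndsAfter (fin bs pos len) bs
finite-ends bs pos len _ n with (length bs + n) <ᵇ length bs | <ᵇ⇒< (length bs + n) (length bs)
... | false | _        = refl
... | true  | inside = ⊥-elim (<⇒≱ (inside tt) (m≤m+n (length bs) n))

infinite-segment : ∀ b pos n → InitialSegment (inf b pos) (applyUpTo b n)
infinite-segment b pos n = record
  { positive = applyUpTo⁺₂ b n pos
  ; codes    = λ i i<l → cong (codeAt i) (sym (lookupD-applyUpTo b n i (subst (i <_) (length-applyUpTo b n) i<l)))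
  }

isEven-length-applyUpTo : ∀ (b : ℕ → ℕ) n → isEven (length (applyUpTo b n)) ≡ isEven n
isEven-length-applyUpTo b n = cong isEven (length-applyUpTo b n)

-- Approximations of r < a/c < r' by finite expansions

record UpperApproximant (r : CFExp) (x : ℕ × ℕ) : Set where
  field
    expansion : List ℕ
    segment   : InitialSegment r expansion
    ends      : EndsAfter r expansion
    value<x   : evalCF expansion <F x

record LowerApproximant (r : CFExp) (x : ℕ × ℕ) : Set where
  field
    expansion : List ℕ
    segment   : InitialSegment r expansion
    even      : isEven (length expansion) ≡ true
    x<value   : x <F evalCF expansion

upper-approximant : ∀ r x → Above r x → UpperApproximant r x
upper-approximant (fin bs pos len) x r<x = record
  { expansion = bs ; segment = finite-segment bs pos len ; ends = finite-ends bs pos len ; value<x = r<x }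
upper-approximant (inf b pos) x (k , conv<x) = record
  { expansion = applyUpTo b (suc (2 * k))
  ; segment   = infinite-segment b pos (suc (2 * k))
  ; ends      = λ even → ⊥-elim (odd-length even)
  ; value<x   = conv<x
  }
  where
  odd-length : isEven (length (applyUpTo b (suc (2 * k)))) ≢ true
  odd-length even with trans (sym (cong not (isEven-double k)))
                         (trans (sym (isEven-length-applyUpTo b (suc (2 * k)))) even)
  ... | ()

lower-approximant : ∀ r x → Below x r → LowerApproximant r x
lower-approximant (fin bs pos (l , len)) x x<r = record
  { expansion = bs ; segment = finite-segment bs pos (l , len)
  ; even = trans (cong isEven len) (isEven-double (suc l)) ; x<value = x<r }
lower-approximant (inf b pos) x (k , x<conv) = record
  { expansion = applyUpTo b (2 * k)
  ; segment   = infinite-segment b pos (2 * k)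
  ; even      = trans (isEven-length-applyUpTo b (2 * k)) (isEven-double k)
  ; x<value   = x<conv
  }

code-order : ∀ P {y t y' t'} → 1 ≤ y × All (1 ≤_) t → 1 ≤ y' × All (1 ≤_) t' → y ≢ y' →
             evalCF (P ++ y ∷ t) <F evalCF (P ++ y' ∷ t') → codeAt (length P) y ≺ codeAt (length P) y'
code-order P {y} {t} {y'} {t'} (1≤y , t-pos) (1≤y' , t'-pos) y≢y' lt
  rewrite codeAt-parity (length P) y | codeAt-parity (length P) y'
  with isEven (length P) in parity | <-cmp y y'
... | _     | tri≈ _ y≡y' _ = ⊥-elim (y≢y' y≡y')
... | true  | tri< y<y' _ _ = ⊥-elim (<F⇒≱F (evalCF (P ++ y ∷ t)) (evalCF (P ++ y' ∷ t')) lt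
                                (oriented-even (length P) parity (evalCF-divergence P {t' = t'} y<y' t-pos)))
... | true  | tri> _ _ y'<y = C-I-antitone 1≤y' y'<y
... | false | tri< y<y' _ _ = C-II-monotone 1≤y y<y'
... | false | tri> _ _ y'<y = ⊥-elim (<F⇒≱F (evalCF (P ++ y ∷ t)) (evalCF (P ++ y' ∷ t')) lt
                                (oriented-odd (length P) parity (evalCF-divergence P {t' = t} y'<y t'-pos)))

lex-at-divergence : ∀ {r r'} P {y t y' t'} →
  InitialSegment r (P ++ y ∷ t) → InitialSegment r' (P ++ y' ∷ t') → y ≢ y' →
  evalCF (P ++ y ∷ t) <F evalCF (P ++ y' ∷ t') → C r <lex C r'
lex-at-divergence {r} {r'} P seg seg' y≢y' lt =
  lex-at-block (length P) (blocks-nonempty r) (blocks-nonempty r')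
    (segments-agree (segment-shorten P seg) (segment-shorten P seg'))
    (subst₂ _≺_ (sym (segment-next-code P seg)) (sym (segment-next-code P seg'))
      (code-order P (segment-next-positive P seg) (segment-next-positive P seg') y≢y' lt))

-- the expansion L of r is a proper prefix of that of r': [L] < [L'] forces |L| to be
-- even, so C(r) continues with 0^ω while C(r') continues with C_I(z) containing a 1
lex-at-termination : ∀ {r r'} L {z t} →
  InitialSegment r L → InitialSegment r' (L ++ z ∷ t) → EndsAfter r L →
  evalCF L <F evalCF (L ++ z ∷ t) → C r <lex C r'
lex-at-termination {r} {r'} L {z} {t} seg seg' ends lt with even-or-odd (length L)
... | inj₂ odd  = ⊥-elim (<F⇒≱F (evalCF L) (evalCF (L ++ z ∷ t)) lt
                    (oriented-odd (length L) odd (evalCF-extension L (z ∷ t))))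
... | inj₁ even = lex-after-common-blocks (length L) (suc l) 1 (blocks-nonempty r) (blocks-nonempty r')
                (segments-agree seg (segment-shorten L seg'))
                (subst₂ _≺_ (sym (firstBlocks-zeros (ends even) (suc l))) (sym next-block)
                  (subst (replicate (suc l) false ≺_) (sym (++-assoc (replicate l false) (true ∷ _) []))
                    (zeros≺ l _)))
  where
  l = ⌊log₂ z ⌋
  next-block : blocks r' (length L + 0) ++ [] ≡ C-I z ++ []
  next-block = cong (_++ []) (begin
      blocks r' (length L + 0)                               ≡⟨ cong (blocks r') (+-identityʳ (length L)) ⟩
      blocks r' (length L)                                   ≡⟨ segment-next-code L seg' ⟩
      codeAt (length L) z                                    ≡⟨ codeAt-parity (length L) z ⟩
      (if isEven (length L) then C-I z else C-II z)          ≡⟨ cong (λ b → if b then C-I z else C-II z) even ⟩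
      C-I z                                                  ∎)
    where open ≡-Reasoning

lex-from-segments : ∀ {r r' L L'} → InitialSegment r L → InitialSegment r' L' → EndsAfter r L →
                    isEven (length L') ≡ true → evalCF L <F evalCF L' → C r <lex C r'
lex-from-segments {L = L} {L'} seg seg' ends even' lt with first-difference L L'
... | equal refl                          = ⊥-elim (<-irrefl refl lt)
... | proper-extension z t refl           = ⊥-elim (<F⇒≱F (evalCF (L' ++ z ∷ t)) (evalCF L') lt
                                           (oriented-even (length L') even' (evalCF-extension L' (z ∷ t))))
... | proper-prefix z t refl              = lex-at-termination L seg seg' ends lt
... | diverge P y t y' t' y≢y' refl refl = lex-at-divergence P seg seg' y≢y' lt

mainTheorem2 : (r r' : CFExp) → r <ℝ r' → C r <lex C r'
mainTheorem2 r r' (a , c , _ , r<x , x<r') =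
  lex-from-segments U.segment O.segment U.ends O.even
    (<F-trans (evalCF U.expansion) (a , c) (evalCF O.expansion)
              (evalCF-denominator-positive U.expansion (InitialSegment.positive U.segment))
              (evalCF-denominator-positive O.expansion (InitialSegment.positive O.segment))
              U.value<x O.x<value)
  where
  module U = UpperApproximant (upper-approximant r (a , c) r<x)
  module O = LowerApproximant (lower-approximant r' (a , c) x<r')
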